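{- Let $\mathcal{H}$ be a $2$-uniform hypergraph and let $a,b \in \mathbb{Z}_+$ with $a \geq 2$. Breaker wins the $(a,b)$-game on $\mathcal{H}$ if and only if the edges of $\mathcal{H}$ are pairwise disjoint and $b \geq \min(a,|E(\mathcal{H})|)$.
   Context: A hypergraph $\mathcal{H}$ consists of a finite vertex set $V(\mathcal{H})$ and a set $E(\mathcal{H})$ of subsets of $V(\mathcal{H})$ (edges); it is $k$-uniform if every edge has exactly $k$ vertices. For $a,b$ (nonnegative integers or $\ast$ = unlimited supply), the $(a,b)$-game on $\mathcal{H}$: Maker has $a$ tokens and Breaker has $b$ tokens; initially the board is empty. Players alternate turns, Maker first. On a turn a player may pass, or place one of their own tokens on an unoccupied vertex, the token being either not yet used or moved from its current vertex on the board (which becomes unoccupied). Maker wins as soon as all vertices of some edge carry Maker tokens; Breaker wins if this never happens or if the game reaches the same state (token placement and player to move) twice. "Breaker wins" means Breaker has a winning strategy. -}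

module Defs where

open import Data.Nat using (ℕ; _<_)
open import Data.Fin using (Fin)
open import Data.Fin.Subset as S using (Subset; _⊆_; _∩_; ∣_∣; inside; outside)
  renaming (_∈_ to _∈ˢ_; _∉_ to _∉ˢ_; ⊥ to ∅ˢ)
open import Data.Vec using (_[_]≔_)
open import Data.List using (List; []; _∷_)
open import Data.List.Membership.Propositional using () renaming (_∈_ to _∈ˡ_)
open import Data.List.Relation.Unary.All using (All)
open import Data.Product using (Σ; ∃; _×_; _,_)
open import Relation.Binary.PropositionalEquality using (_≡_; _≢_)
open import Relation.Nullary using (¬_)

-- A hypergraph on vertex set Fin n is given by its list of edges
-- (each edge a subset of Fin n); distinctness of edges is imposed
-- separately (Unique) so that the list represents a set of edges.

TwoUniform : ∀ {n} → List (Subset n) → Set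
TwoUniform E = All (λ e → ∣ e ∣ ≡ 2) E

PairwiseDisjoint : ∀ {n} → List (Subset n) → Set
PairwiseDisjoint E = ∀ {e f} → e ∈ˡ E → f ∈ˡ E → e ≢ f → S.Empty (e ∩ f)

data Player : Set where
  maker breaker : Player

-- Game state: set of vertices with Maker tokens, set of vertices with
-- Breaker tokens, and the player to move.  (Tokens of one player are
-- indistinguishable, so this is the token placement.)
record State (n : ℕ) : Set where
  constructor st
  field
    makerSet   : Subset n
    breakerSet : Subset n
    toMove     : Player

-- One turn of a player owning `cap` tokens, whose occupied set is S,
-- the opponent's occupied set being T; S' is the resulting set.
data Move {n : ℕ} (cap : ℕ) (S T : Subset n) : Subset n → Set where
  pass  : Move cap S T S
  place : (v : Fin n) → v ∉ˢ S → v ∉ˢ T → ∣ S ∣ < cap →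
          Move cap S T (S [ v ]≔ inside)
  shift : (u v : Fin n) → u ∈ˢ S → v ∉ˢ S → v ∉ˢ T →
          Move cap S T ((S [ u ]≔ outside) [ v ]≔ inside)

MakerWon : ∀ {n} → List (Subset n) → Subset n → Set
MakerWon E M = ∃ λ e → e ∈ˡ E × e ⊆ M

data BWin {n : ℕ} (E : List (Subset n)) (a b : ℕ) :
          List (State n) → State n → Set where
  repeated    : ∀ {hist s} → s ∈ˡ hist → BWin E a b hist s
  makerTurn   : ∀ {hist M B} →
                (∀ M' → Move a M B M' →
                   ¬ MakerWon E M' × BWin E a b (st M B maker ∷ hist) (st M' B breaker)) →
                BWin E a b hist (st M B maker)
  breakerTurn : ∀ {hist M B} →
                (Σ (Subset n) λ B' → Move b B M B' × BWin E a b (st M B breaker ∷ hist) (st M B' maker)) →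
                BWin E a b hist (st M B breaker)

BreakerWins : ∀ {n} → List (Subset n) → ℕ → ℕ → Set
BreakerWins E a b = BWin E a b [] (st ∅ˢ ∅ˢ maker)

-- If two edges share a vertex x,
-- Maker claims x; Breaker's answer adds at most one token, so one neighbour of x stays
-- free and Maker's second token completes that edge.
--
-- If the edges are pairwise disjoint and a ⊓ |E| ≤ b, Breaker answers every new Maker
-- vertex by occupying its partner, moving an idle token (one with no Maker neighbour) if
-- he has none left: the needed tokens together with the new partner are matched
-- injectively into Maker's tokens and into the edges, so there are at most a ⊓ |E| ≤ b
-- of them. Every edge Maker enters is thus blocked, and Breaker wins by repetition since
-- there are finitely many positions.
--
-- If b < a and b < |E|, Maker completes any edge he has entered whose other vertex is
-- free. Otherwise each of his tokens faces a Breaker token, so he holds at most b < a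
-- tokens, and at most b < |E| edges contain a Breaker token, so he can enter a free edge.
-- His token count grows every round but stays at most b, so a completable edge appears.

module Submission where

open import Defs
open import Data.Nat using (ℕ; zero; suc; _+_; _*_; _≤_; _<_; _⊓_; z≤n; s≤s; s≤s⁻¹; _<?_)
open import Data.Nat.Properties
  using (≤-refl; ≤-reflexive; n≤1+n; ≤-trans; <-trans; ≤-<-trans; <-irrefl; <⇒≱; ≤⇒≯; ≮⇒≥;
         n<1+n; +-identityʳ; +-suc; *-suc; ⊓-glb; ⊓-monoˡ-≤; m<n⊓o⇒m<n; m<n⊓o⇒m<o; module ≤-Reasoning)
open import Data.Bool.Properties using () renaming (_≟_ to _≟ᵇ_)
open import Data.Fin using (Fin; zero; suc)
open import Data.Fin.Properties using (any?; injective⇒≤; suc-injective) renaming (_≟_ to _≟ᶠ_)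
open import Data.Fin.Subset using (Subset; ∣_∣; inside; outside; _∩_; _⊆_; Nonempty)
  renaming (_∈_ to _∈ˢ_; _∉_ to _∉ˢ_; ⊥ to ∅ˢ)
open import Data.Fin.Subset.Properties using (_∈?_; nonempty?; ∉⊥; ∣⊥∣≡0; x∈p∩q⁺; x∈p∩q⁻; ⊆-antisym)
open import Data.Vec using ([]; _∷_; _[_]≔_; here; there)
open import Data.Vec.Properties
  using (≡-dec; []≔-updates; []≔-minimal; []=-injective; []=⇒lookup; lookup⇒[]=; lookup∘update′)
open import Data.List using (List; []; _∷_; length; map; lookup; cartesianProduct; cartesianProductWith)
open import Data.List.Properties using (length-map)
open import Data.List.Relation.Unary.Any as Any using (Any; here; there; index)
open import Data.List.Relation.Unary.Any.Properties using (lookup-index)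
open import Data.List.Relation.Unary.All as All using (All; []; _∷_)
open import Data.List.Relation.Unary.All.Properties using (¬Any⇒All¬) renaming (map⁺ to All-map⁺)
open import Data.List.Membership.Propositional using (find; lose) renaming (_∈_ to _∈ˡ_; _∉_ to _∉ˡ_)
open import Data.List.Membership.Propositional.Properties
  using (∈-lookup; ∈-map⁺; ∈-map⁻; ∈-cartesianProductWith⁺)
open import Data.List.Relation.Unary.Unique.Propositional using (Unique)
open import Data.List.Relation.Unary.AllPairs using ([]; _∷_)
import Data.List.Relation.Unary.Unique.Propositional.Properties as Unique
open import Data.Product using (∃; ∃₂; _×_; _,_; proj₁; proj₂; uncurry; swap)
open import Data.Sum as Sum using (_⊎_; inj₁; inj₂; [_,_])
open import Function using (_∘_)
open import Function.Bundles using (_⇔_; mk⇔)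
open import Relation.Binary.Definitions using (DecidableEquality)
open import Relation.Binary.PropositionalEquality
  using (_≡_; _≢_; refl; sym; trans; cong; subst; subst₂; module ≡-Reasoning)
open import Relation.Nullary using (¬_; Dec; yes; no; contradiction)
open import Relation.Nullary.Decidable using (_×-dec_; ¬?; decidable-stable; map′)

private variable
  n cap : ℕ
  x y z w w′ : Fin n
  p q e f S T S′ M B M′ B′ : Subset n
  a b : ℕ
  E : List (Subset n)
  hist : List (State n)

Unique-lookup-injective : ∀ {A : Set} {xs : List A} → Unique xs → ∀ i j → lookup xs i ≡ lookup xs j → i ≡ j
Unique-lookup-injective (_ ∷ _) zero zero _ = refl
Unique-lookup-injective (x≢ ∷ _) zero (suc j) eq = contradiction eq (All.lookup x≢ (∈-lookup j))
Unique-lookup-injective (x≢ ∷ _) (suc i) zero eq = contradiction (sym eq) (All.lookup x≢ (∈-lookup i))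
Unique-lookup-injective (_ ∷ u) (suc i) (suc j) eq = cong suc (Unique-lookup-injective u i j eq)

injection⇒length≤ : ∀ {A B : Set} (R : A → B → Set) {xs : List A} {ys : List B} → Unique xs →
  (∀ {x} → x ∈ˡ xs → ∃ λ y → y ∈ˡ ys × R x y) →
  (∀ {x x′ y} → x ∈ˡ xs → x′ ∈ˡ xs → y ∈ˡ ys → R x y → R x′ y → x ≡ x′) →
  length xs ≤ length ys
injection⇒length≤ {B = B} R {xs} {ys} unique image injective = injective⇒≤ position-injective
  where
  target : Fin (length xs) → B
  target i = proj₁ (image (∈-lookup i))

  target∈ : ∀ i → target i ∈ˡ ys
  target∈ i = proj₁ (proj₂ (image (∈-lookup i)))

  related : ∀ i → R (lookup xs i) (target i)
  related i = proj₂ (proj₂ (image (∈-lookup i)))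

  position : Fin (length xs) → Fin (length ys)
  position i = index (target∈ i)

  position-injective : ∀ {i j} → position i ≡ position j → i ≡ j
  position-injective {i} {j} eq = Unique-lookup-injective unique i j
    (injective (∈-lookup i) (∈-lookup j) (target∈ i) (related i) (subst (R _) (sym same-target) (related j)))
    where
    open ≡-Reasoning
    same-target : target i ≡ target j
    same-target = begin
      target i               ≡⟨ lookup-index (target∈ i) ⟩
      lookup ys (position i) ≡⟨ cong (lookup ys) eq ⟩
      lookup ys (position j) ≡⟨ lookup-index (target∈ j) ⟨
      target j               ∎

Unique⊆⇒length≤ : ∀ {A : Set} {xs ys : List A} → Unique xs → (∀ {x} → x ∈ˡ xs → x ∈ˡ ys) → length xs ≤ length ys
Unique⊆⇒length≤ unique ⊆ys =
  injection⇒length≤ _≡_ unique (λ x∈ → _ , ⊆ys x∈ , refl) (λ _ _ _ p q → trans p (sym q))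

∈-update⁻ : ∀ {s} → y ≢ x → y ∈ˢ p [ x ]≔ s → y ∈ˢ p
∈-update⁻ {y = y} {p = p} y≢x y∈ = lookup⇒[]= y p (trans (sym (lookup∘update′ y≢x p _)) ([]=⇒lookup y∈))

∈-update⁺ : ∀ {s} → y ≢ x → y ∈ˢ p → y ∈ˢ p [ x ]≔ s
∈-update⁺ {y = y} {x = x} {p = p} y≢x = []≔-minimal p y x y≢x

x∉p[x]≔outside : (p : Subset n) (x : Fin n) → x ∉ˢ p [ x ]≔ outside
x∉p[x]≔outside p x x∈ = contradiction ([]=-injective ([]≔-updates p x) x∈) λ ()

∈-insert⁻ : y ∈ˢ p [ x ]≔ inside → y ≡ x ⊎ y ∈ˢ p
∈-insert⁻ {y = y} {x = x} y∈ with y ≟ᶠ x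
... | yes y≡x = inj₁ y≡x
... | no y≢x = inj₂ (∈-update⁻ y≢x y∈)

∈-insert⁺ : y ∈ˢ p → y ∈ˢ p [ x ]≔ inside
∈-insert⁺ {y = y} {p = p} {x = x} y∈ with y ≟ᶠ x
... | yes refl = []≔-updates p y
... | no y≢x = ∈-update⁺ y≢x y∈

∈-remove⁻ : y ∈ˢ p [ x ]≔ outside → y ∈ˢ p
∈-remove⁻ {y = y} {p = p} {x = x} y∈ with y ≟ᶠ x
... | yes refl = contradiction y∈ (x∉p[x]≔outside p y)
... | no y≢x = ∈-update⁻ y≢x y∈

∣insert∣ : x ∉ˢ p → ∣ p [ x ]≔ inside ∣ ≡ suc ∣ p ∣
∣insert∣ {x = zero} {p = inside ∷ p} x∉ = contradiction here x∉
∣insert∣ {x = zero} {p = outside ∷ p} x∉ = refl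
∣insert∣ {x = suc x} {p = inside ∷ p} x∉ = cong suc (∣insert∣ (x∉ ∘ there))
∣insert∣ {x = suc x} {p = outside ∷ p} x∉ = ∣insert∣ (x∉ ∘ there)

∣remove∣ : x ∈ˢ p → ∣ p ∣ ≡ suc ∣ p [ x ]≔ outside ∣
∣remove∣ here = refl
∣remove∣ {p = inside ∷ p} (there x∈) = cong suc (∣remove∣ x∈)
∣remove∣ {p = outside ∷ p} (there x∈) = ∣remove∣ x∈

0<∣p∣⇒Nonempty : 0 < ∣ p ∣ → Nonempty p
0<∣p∣⇒Nonempty {p = inside ∷ p} _ = zero , here
0<∣p∣⇒Nonempty {p = outside ∷ p} 0<∣p∣ with x , x∈ ← 0<∣p∣⇒Nonempty 0<∣p∣ = suc x , there x∈

∃-other : x ∈ˢ p → 1 < ∣ p ∣ → ∃ λ y → y ∈ˢ p × y ≢ x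
∃-other {x = x} {p = p} x∈ 1<∣p∣
  with y , y∈ ← 0<∣p∣⇒Nonempty {p = p [ x ]≔ outside} (s≤s⁻¹ (subst (1 <_) (∣remove∣ x∈) 1<∣p∣))
  = y , ∈-remove⁻ y∈ , λ { refl → x∉p[x]≔outside p x y∈ }

elements : Subset n → List (Fin n)
elements [] = []
elements (inside ∷ p) = zero ∷ map suc (elements p)
elements (outside ∷ p) = map suc (elements p)

∈-elements⁺ : x ∈ˢ p → x ∈ˡ elements p
∈-elements⁺ {p = inside ∷ p} here = here refl
∈-elements⁺ {p = inside ∷ p} (there x∈) = there (∈-map⁺ suc (∈-elements⁺ x∈))
∈-elements⁺ {p = outside ∷ p} (there x∈) = ∈-map⁺ suc (∈-elements⁺ x∈)

∈-elements⁻ : x ∈ˡ elements p → x ∈ˢ p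
∈-elements⁻ {p = inside ∷ p} (here refl) = here
∈-elements⁻ {p = inside ∷ p} (there x∈) with _ , y∈ , refl ← ∈-map⁻ suc x∈ = there (∈-elements⁻ y∈)
∈-elements⁻ {p = outside ∷ p} x∈ with _ , y∈ , refl ← ∈-map⁻ suc x∈ = there (∈-elements⁻ y∈)

length-elements : (p : Subset n) → length (elements p) ≡ ∣ p ∣
length-elements [] = refl
length-elements (inside ∷ p) = cong suc (trans (length-map suc (elements p)) (length-elements p))
length-elements (outside ∷ p) = trans (length-map suc (elements p)) (length-elements p)

elements-unique : (p : Subset n) → Unique (elements p)
elements-unique [] = []
elements-unique (inside ∷ p) =
  All-map⁺ (All.universal (λ _ ()) (elements p)) ∷ Unique.map⁺ suc-injective (elements-unique p)
elements-unique (outside ∷ p) = Unique.map⁺ suc-injective (elements-unique p)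

Unique⊆⇒length≤∣p∣ : ∀ {xs : List (Fin n)} → Unique xs → (∀ {x} → x ∈ˡ xs → x ∈ˢ p) → length xs ≤ ∣ p ∣
Unique⊆⇒length≤∣p∣ {p = p} unique ⊆p =
  subst (_ ≤_) (length-elements p) (Unique⊆⇒length≤ unique (∈-elements⁺ ∘ ⊆p))

∈-insert-fresh : y ∈ˢ p [ x ]≔ inside → y ∉ˢ p → y ≡ x
∈-insert-fresh y∈ y∉ = Sum.fromInj₁ (λ y∈p → contradiction y∈p y∉) (∈-insert⁻ y∈)

Move-fresh-unique : Move cap S T S′ → x ∈ˢ S′ → x ∉ˢ S → y ∈ˢ S′ → y ∉ˢ S → x ≡ y
Move-fresh-unique pass x∈ x∉ _ _ = contradiction x∈ x∉
Move-fresh-unique (place _ _ _ _) x∈ x∉ y∈ y∉ = trans (∈-insert-fresh x∈ x∉) (sym (∈-insert-fresh y∈ y∉))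
Move-fresh-unique (shift _ _ _ _ _) x∈ x∉ y∈ y∉ =
  trans (∈-insert-fresh x∈ (x∉ ∘ ∈-remove⁻)) (sym (∈-insert-fresh y∈ (y∉ ∘ ∈-remove⁻)))

Move-fresh-free : Move cap S T S′ → x ∈ˢ S′ → x ∉ˢ S → x ∉ˢ T
Move-fresh-free pass x∈ x∉ = contradiction x∈ x∉
Move-fresh-free (place _ _ v∉T _) x∈ x∉ = subst (_∉ˢ _) (sym (∈-insert-fresh x∈ x∉)) v∉T
Move-fresh-free (shift _ _ _ _ v∉T) x∈ x∉ = subst (_∉ˢ _) (sym (∈-insert-fresh x∈ (x∉ ∘ ∈-remove⁻))) v∉T

Move-old : Move cap S T S′ → x ∈ˢ S′ → x ∉ˢ S → y ∈ˢ S′ → y ≢ x → y ∈ˢ S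
Move-old {S = S} {y = y} mv x∈ x∉ y∈ y≢x =
  decidable-stable (y ∈? S) (λ y∉ → y≢x (Move-fresh-unique mv y∈ y∉ x∈ x∉))

Move-∣∣≤ : Move cap S T S′ → ∣ S ∣ ≤ cap → ∣ S′ ∣ ≤ cap
Move-∣∣≤ pass ∣S∣≤cap = ∣S∣≤cap
Move-∣∣≤ (place _ v∉S _ room) _ = subst (_≤ _) (sym (∣insert∣ v∉S)) room
Move-∣∣≤ {S = S} (shift u v u∈S v∉S _) ∣S∣≤cap = subst (_≤ _) (sym same-size) ∣S∣≤cap
  where
  same-size : ∣ (S [ u ]≔ outside) [ v ]≔ inside ∣ ≡ ∣ S ∣
  same-size = trans (∣insert∣ (v∉S ∘ ∈-remove⁻)) (sym (∣remove∣ u∈S))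

claim : 2 ≤ cap → x ∈ˢ S → y ∉ˢ T → ∃ λ S′ → Move cap S T S′ × x ∈ˢ S′ × y ∈ˢ S′
claim {cap = cap} {S = S} {y = y} 2≤cap x∈S y∉T with y ∈? S
... | yes y∈S = S , pass , x∈S , y∈S
... | no y∉S with ∣ S ∣ <? cap
...   | yes room = S [ y ]≔ inside , place y y∉S y∉T room , ∈-insert⁺ x∈S , []≔-updates S y
...   | no full with u , u∈S , u≢x ← ∃-other x∈S (≤-trans 2≤cap (≮⇒≥ full)) =
  (S [ u ]≔ outside) [ y ]≔ inside , shift u y u∈S y∉S y∉T ,
  ∈-insert⁺ (∈-update⁺ (u≢x ∘ sym) x∈S) , []≔-updates _ y

BWin-maker⁻ : st M B maker ∉ˡ hist → BWin E a b hist (st M B maker) → Move a M B M′ →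
  ¬ MakerWon E M′ × BWin E a b (st M B maker ∷ hist) (st M′ B breaker)
BWin-maker⁻ unseen (repeated seen) _ = contradiction seen unseen
BWin-maker⁻ _ (makerTurn next) mv = next _ mv

BWin-breaker⁻ : st M B breaker ∉ˡ hist → BWin E a b hist (st M B breaker) →
  ∃ λ B′ → Move b B M B′ × BWin E a b (st M B breaker ∷ hist) (st M B′ maker)
BWin-breaker⁻ unseen (repeated seen) = contradiction seen unseen
BWin-breaker⁻ _ (breakerTurn reply) = reply

_≟ᵖ_ : DecidableEquality Player
maker ≟ᵖ maker = yes refl
maker ≟ᵖ breaker = no λ ()
breaker ≟ᵖ maker = no λ ()
breaker ≟ᵖ breaker = yes refl

_≟ˢᵗ_ : DecidableEquality (State n)
st M B p ≟ˢᵗ st M′ B′ p′ = map′ (λ { (refl , refl , refl) → refl }) (λ { refl → refl , refl , refl })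
  (≡-dec _≟ᵇ_ M M′ ×-dec ≡-dec _≟ᵇ_ B B′ ×-dec p ≟ᵖ p′)

subsets : (n : ℕ) → List (Subset n)
subsets zero = [] ∷ []
subsets (suc n) = cartesianProductWith _∷_ (inside ∷ outside ∷ []) (subsets n)

∈-subsets : (p : Subset n) → p ∈ˡ subsets n
∈-subsets [] = here refl
∈-subsets (inside ∷ p) = ∈-cartesianProductWith⁺ _∷_ {inside ∷ outside ∷ []} (here refl) (∈-subsets p)
∈-subsets (outside ∷ p) = ∈-cartesianProductWith⁺ _∷_ {inside ∷ outside ∷ []} (there (here refl)) (∈-subsets p)

states : (n : ℕ) → List (State n)
states n = cartesianProductWith (λ M → uncurry (st M)) (subsets n)
  (cartesianProduct (subsets n) (maker ∷ breaker ∷ []))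

∈-states : (s : State n) → s ∈ˡ states n
∈-states (st M B p) =
  ∈-cartesianProductWith⁺ (λ M → uncurry (st M)) (∈-subsets M)
    (∈-cartesianProductWith⁺ _,_ (∈-subsets B) (∈-players p))
  where
  ∈-players : ∀ p → p ∈ˡ maker ∷ breaker ∷ []
  ∈-players maker = here refl
  ∈-players breaker = there (here refl)

breakerWins-by-invariant : (Inv : Subset n → Subset n → Set) →
  (∀ {M B M′} → Inv M B → Move a M B M′ → ¬ MakerWon E M′) →
  (∀ {M B M′} → Inv M B → Move a M B M′ → ∃ λ B′ → Move b B M′ B′ × Inv M′ B′) →
  Inv ∅ˢ ∅ˢ → BreakerWins E a b
breakerWins-by-invariant {n = n} {a = a} {E = E} {b = b} Inv safe respond inv₀ =
  play (suc (length (states n))) [] [] ≤-refl inv₀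
  where
  -- Breaker claims the win at the first repeated position, so the history stays
  -- repetition-free and cannot outgrow the list of all positions.
  play : ∀ fuel hist {M B} → Unique hist → length (states n) < length hist + fuel → Inv M B →
         BWin E a b hist (st M B maker)
  play zero _ unique bound _ =
    contradiction (Unique⊆⇒length≤ unique (λ _ → ∈-states _)) (<⇒≱ (subst (_ <_) (+-identityʳ _) bound))
  play (suc fuel) hist {M} {B} unique bound inv with Any.any? (st M B maker ≟ˢᵗ_) hist
  ... | yes seen = repeated seen
  ... | no unseen = makerTurn λ M′ mv → safe inv mv , reply M′ mv
    where
    bound′ : length (states n) < suc (suc (length hist)) + fuel
    bound′ = ≤-trans bound (≤-trans (≤-reflexive (+-suc (length hist) fuel)) (n≤1+n _))

    reply : ∀ M′ → Move a M B M′ → BWin E a b (st M B maker ∷ hist) (st M′ B breaker)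
    reply M′ mv with Any.any? (st M′ B breaker ≟ˢᵗ_) (st M B maker ∷ hist)
    ... | yes seen′ = repeated seen′
    ... | no unseen′ with B′ , mv′ , inv′ ← respond inv mv =
      breakerTurn (B′ , mv′ , play fuel _ (¬Any⇒All¬ _ unseen′ ∷ ¬Any⇒All¬ _ unseen ∷ unique) bound′ inv′)

Adjacent : List (Subset n) → Fin n → Fin n → Set
Adjacent E x y = x ≢ y × Any (λ e → x ∈ˢ e × y ∈ˢ e) E

adjacent? : (E : List (Subset n)) → ∀ x y → Dec (Adjacent E x y)
adjacent? E x y = ¬? (x ≟ᶠ y) ×-dec Any.any? (λ e → x ∈? e ×-dec y ∈? e) E

Adjacent-sym : Adjacent E x y → Adjacent E y x
Adjacent-sym (x≢y , x,y∈e) = x≢y ∘ sym , Any.map swap x,y∈e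

HasNeighbourIn : List (Subset n) → Subset n → Fin n → Set
HasNeighbourIn E q x = ∃ λ y → y ∈ˢ q × Adjacent E x y

hasNeighbourIn? : (E : List (Subset n)) (q : Subset n) → ∀ x → Dec (HasNeighbourIn E q x)
hasNeighbourIn? E q x = any? λ y → y ∈? q ×-dec adjacent? E x y

Threat : List (Subset n) → Subset n → Subset n → Set
Threat E M B = ∃₂ λ x y → x ∈ˢ M × Adjacent E x y × y ∉ˢ B

threat? : (E : List (Subset n)) (M B : Subset n) → Dec (Threat E M B)
threat? E M B = any? λ x → any? λ y → x ∈? M ×-dec adjacent? E x y ×-dec ¬? (y ∈? B)

module TwoUniformEdges {n} {E : List (Subset n)} (two-uniform : TwoUniform E) where

  edge-size : e ∈ˡ E → ∣ e ∣ ≡ 2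
  edge-size = All.lookup two-uniform

  edge-nonempty : e ∈ˡ E → Nonempty e
  edge-nonempty e∈E = 0<∣p∣⇒Nonempty (subst (0 <_) (sym (edge-size e∈E)) (s≤s z≤n))

  partner : e ∈ˡ E → x ∈ˢ e → ∃ λ y → y ∈ˢ e × Adjacent E x y
  partner e∈E x∈e with y , y∈e , y≢x ← ∃-other x∈e (subst (1 <_) (sym (edge-size e∈E)) ≤-refl) =
    y , y∈e , y≢x ∘ sym , lose e∈E (x∈e , y∈e)

  edge-only : e ∈ˡ E → x ∈ˢ e → y ∈ˢ e → z ∈ˢ e → x ≢ y → x ≢ z → y ≡ z
  edge-only {e = e} {x = x} {y = y} {z = z} e∈E x∈e y∈e z∈e x≢y x≢z with y ≟ᶠ z
  ... | yes y≡z = y≡z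
  ... | no y≢z = contradiction (subst (3 ≤_) (edge-size e∈E) (Unique⊆⇒length≤∣p∣ distinct ⊆e)) λ { (s≤s (s≤s ())) }
    where
    distinct : Unique (x ∷ y ∷ z ∷ [])
    distinct = (x≢y ∷ x≢z ∷ []) ∷ (y≢z ∷ []) ∷ [] ∷ []

    ⊆e : ∀ {v} → v ∈ˡ x ∷ y ∷ z ∷ [] → v ∈ˢ e
    ⊆e (here refl) = x∈e
    ⊆e (there (here refl)) = y∈e
    ⊆e (there (there (here refl))) = z∈e

  edge⊆ : e ∈ˡ E → x ∈ˢ e → y ∈ˢ e → x ≢ y → x ∈ˢ T → y ∈ˢ T → e ⊆ T
  edge⊆ {e = e} {x = x} {T = T} e∈E x∈e y∈e x≢y x∈T y∈T = e⊆T
    where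
    e⊆T : e ⊆ T
    e⊆T {v} v∈e with x ≟ᶠ v
    ... | yes refl = x∈T
    ... | no x≢v = subst (_∈ˢ T) (edge-only e∈E x∈e y∈e v∈e x≢y x≢v) y∈T

  threat⇒¬BWin : 2 ≤ a → st M B maker ∉ˡ hist → Threat E M B → ¬ BWin E a b hist (st M B maker)
  threat⇒¬BWin 2≤a unseen (x , y , x∈M , (x≢y , x,y∈e) , y∉B) bw
    with e , e∈E , x∈e , y∈e ← find x,y∈e
    with M′ , mv , x∈M′ , y∈M′ ← claim 2≤a x∈M y∉B
    = proj₁ (BWin-maker⁻ unseen bw mv) (e , e∈E , edge⊆ e∈E x∈e y∈e x≢y x∈M′ y∈M′)

  BreakerWins⇒PairwiseDisjoint : 2 ≤ a → BreakerWins E a b → PairwiseDisjoint E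
  BreakerWins⇒PairwiseDisjoint {a = a} 2≤a bw {e} {f} e∈E f∈E e≢f (x , x∈e∩f)
    with x∈e , x∈f ← x∈p∩q⁻ e f x∈e∩f
    with y , y∈e , x~y ← partner e∈E x∈e
    with z , z∈f , x~z ← partner f∈E x∈f
    with _ , bw₁ ← BWin-maker⁻ (λ ()) bw (place x ∉⊥ ∉⊥ (subst (_< a) (sym (∣⊥∣≡0 n)) (≤-trans (s≤s z≤n) 2≤a)))
    with B₁ , mv₁ , bw₂ ← BWin-breaker⁻ (λ { (here ()) ; (there ()) }) bw₁
    = threat⇒¬BWin 2≤a unseen (x , proj₁ free-partner , []≔-updates ∅ˢ x , proj₂ free-partner) bw₂
    where
    y≢z : y ≢ z
    y≢z refl = e≢f (⊆-antisym (edge⊆ e∈E x∈e y∈e (proj₁ x~y) x∈f z∈f) (edge⊆ f∈E x∈f z∈f (proj₁ x~z) x∈e y∈e))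

    free-partner : ∃ λ w → Adjacent E x w × w ∉ˢ B₁
    free-partner with y ∈? B₁
    ... | no y∉B₁ = y , x~y , y∉B₁
    ... | yes y∈B₁ = z , x~z , λ z∈B₁ → y≢z (Move-fresh-unique mv₁ y∈B₁ ∉⊥ z∈B₁ ∉⊥)

    unseen : st (∅ˢ [ x ]≔ inside) B₁ maker ∉ˡ st (∅ˢ [ x ]≔ inside) ∅ˢ breaker ∷ st ∅ˢ ∅ˢ maker ∷ []
    unseen (there (here eq)) = ∉⊥ (subst (x ∈ˢ_) (cong State.makerSet eq) ([]≔-updates ∅ˢ x))

module Matching {n} {E : List (Subset n)} (two-uniform : TwoUniform E) (disjoint : PairwiseDisjoint E) where
  open TwoUniformEdges two-uniform

  edge-unique : e ∈ˡ E → f ∈ˡ E → x ∈ˢ e → x ∈ˢ f → e ≡ f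
  edge-unique {e = e} {f = f} {x = x} e∈E f∈E x∈e x∈f with ≡-dec _≟ᵇ_ e f
  ... | yes e≡f = e≡f
  ... | no e≢f = contradiction (x , x∈p∩q⁺ (x∈e , x∈f)) (disjoint e∈E f∈E e≢f)

  Adjacent-functional : Adjacent E x y → Adjacent E x z → y ≡ z
  Adjacent-functional (x≢y , x,y∈e) (x≢z , x,z∈f)
    with e , e∈E , x∈e , y∈e ← find x,y∈e
    with f , f∈E , x∈f , z∈f ← find x,z∈f
    with refl ← edge-unique e∈E f∈E x∈e x∈f
    = edge-only e∈E x∈e y∈e z∈f x≢y x≢z

  neighbours⇒∣p∣≤∣q∣ : (∀ {x} → x ∈ˢ p → HasNeighbourIn E q x) → ∣ p ∣ ≤ ∣ q ∣
  neighbours⇒∣p∣≤∣q∣ {p = p} {q = q} neighbour =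
    subst₂ _≤_ (length-elements p) (length-elements q) (injection⇒length≤ (Adjacent E) (elements-unique p) image
      (λ _ _ _ x~y x′~y → Adjacent-functional (Adjacent-sym x~y) (Adjacent-sym x′~y)))
    where
    image : ∀ {x} → x ∈ˡ elements p → ∃ λ y → y ∈ˡ elements q × Adjacent E x y
    image x∈ with y , y∈q , x~y ← neighbour (∈-elements⁻ x∈) = y , ∈-elements⁺ y∈q , x~y

  neighbours⇒∣p∣≤∣E∣ : (∀ {x} → x ∈ˢ p → HasNeighbourIn E q x) → (∀ {x} → x ∈ˢ p → x ∉ˢ q) → ∣ p ∣ ≤ length E
  neighbours⇒∣p∣≤∣E∣ {p = p} {q = q} neighbour p∩q≡∅ =
    subst (_≤ _) (length-elements p) (injection⇒length≤ (λ x e → x ∈ˢ e) (elements-unique p) image same-edge)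
    where
    image : ∀ {x} → x ∈ˡ elements p → ∃ λ e → e ∈ˡ E × x ∈ˢ e
    image x∈ with _ , _ , _ , x,y∈e ← neighbour (∈-elements⁻ x∈)
      with e , e∈E , x∈e , _ ← find x,y∈e = e , e∈E , x∈e

    same-edge : ∀ {x x′ e} → x ∈ˡ elements p → x′ ∈ˡ elements p → e ∈ˡ E → x ∈ˢ e → x′ ∈ˢ e → x ≡ x′
    same-edge {x} {x′} x∈ x′∈ e∈E x∈e x′∈e with x ≟ᶠ x′
    ... | yes x≡x′ = x≡x′
    ... | no x≢x′ with y , y∈q , x~y ← neighbour (∈-elements⁻ x∈) =
      contradiction (subst (_∈ˢ q) (Adjacent-functional x~y (x≢x′ , lose e∈E (x∈e , x′∈e))) y∈q)
        (p∩q≡∅ (∈-elements⁻ x′∈))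

  meets⇒∣E∣≤∣q∣ : Unique E → (∀ {e} → e ∈ˡ E → Nonempty (e ∩ q)) → length E ≤ ∣ q ∣
  meets⇒∣E∣≤∣q∣ {q = q} unique meets =
    subst (_ ≤_) (length-elements q) (injection⇒length≤ (λ e x → x ∈ˢ e) unique image
      (λ e∈E f∈E _ x∈e x∈f → edge-unique e∈E f∈E x∈e x∈f))
    where
    image : ∀ {e} → e ∈ˡ E → ∃ λ x → x ∈ˡ elements q × x ∈ˢ e
    image {e} e∈E with x , x∈e∩q ← meets e∈E with x∈e , x∈q ← x∈p∩q⁻ e q x∈e∩q = x , ∈-elements⁺ x∈q , x∈e

module BlockingStrategy {n} {E : List (Subset n)} (two-uniform : TwoUniform E) (disjoint : PairwiseDisjoint E)
  {a b : ℕ} (min≤b : a ⊓ length E ≤ b) where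
  open TwoUniformEdges two-uniform
  open Matching two-uniform disjoint

  record Blocking (M B : Subset n) : Set where
    field
      separate : ∀ {x} → x ∈ˢ M → x ∉ˢ B
      blocked  : ∀ {x y} → x ∈ˢ M → Adjacent E x y → y ∈ˢ B
      bounded  : ∣ M ∣ ≤ a
  open Blocking

  separate′ : Blocking M B → Move a M B M′ → x ∈ˢ M′ → x ∉ˢ B
  separate′ {M = M} {x = x} inv mv x∈M′ with x ∈? M
  ... | yes x∈M = separate inv x∈M
  ... | no x∉M = Move-fresh-free mv x∈M′ x∉M

  safe : Blocking M B → Move a M B M′ → ¬ MakerWon E M′
  safe {M = M} inv mv (e , e∈E , e⊆M′)
    with x , x∈e ← edge-nonempty e∈E
    with y , y∈e , x~y ← partner e∈E x∈e
    with x ∈? M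
  ... | yes x∈M = separate′ inv mv (e⊆M′ y∈e) (blocked inv x∈M x~y)
  ... | no x∉M = separate′ inv mv (e⊆M′ x∈e)
                   (blocked inv (Move-old mv (e⊆M′ x∈e) x∉M (e⊆M′ y∈e) (proj₁ x~y ∘ sym)) (Adjacent-sym x~y))

  Blocking-after-fresh : Blocking M B → Move a M B M′ → w ∈ˢ M′ → w ∉ˢ M →
    (∀ {y} → y ∈ˢ B′ → Adjacent E w y ⊎ y ∈ˢ B) →
    (∀ {y} → Adjacent E w y → y ∈ˢ B′) →
    (∀ {y} → y ∈ˢ B → HasNeighbourIn E M′ y → y ∈ˢ B′) →
    Blocking M′ B′
  Blocking-after-fresh {M = M} {M′ = M′} {w = w} {B′ = B′} inv mv w∈M′ w∉M B′⊆ covers keeps = record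
    { separate = λ x∈M′ x∈B′ → [ (λ w~x → w-unblocked x∈M′ w~x) , separate′ inv mv x∈M′ ] (B′⊆ x∈B′)
    ; blocked  = blocked′
    ; bounded  = Move-∣∣≤ mv (bounded inv)
    }
    where
    old : x ∈ˢ M′ → x ≢ w → x ∈ˢ M
    old = Move-old mv w∈M′ w∉M

    w-unblocked : x ∈ˢ M′ → ¬ Adjacent E w x
    w-unblocked x∈M′ w~x =
      Move-fresh-free mv w∈M′ w∉M (blocked inv (old x∈M′ (proj₁ w~x ∘ sym)) (Adjacent-sym w~x))

    blocked′ : ∀ {x y} → x ∈ˢ M′ → Adjacent E x y → y ∈ˢ B′
    blocked′ {x} x∈M′ x~y with x ≟ᶠ w
    ... | yes refl = covers x~y
    ... | no x≢w = keeps (blocked inv (old x∈M′ x≢w) x~y) (x , x∈M′ , Adjacent-sym x~y)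

  cover-partner : Blocking M B → Move a M B M′ → w ∈ˢ M′ → w ∉ˢ M → Adjacent E w w′ →
    ∃ λ B′ → Move b B M′ B′ × Blocking M′ B′
  cover-partner {B = B} {M′ = M′} {w = w} {w′ = w′} inv mv w∈M′ w∉M w~w′ = cases
    where
    w′∉M′ : w′ ∉ˢ M′
    w′∉M′ w′∈M′ = Move-fresh-free mv w∈M′ w∉M
      (blocked inv (Move-old mv w∈M′ w∉M w′∈M′ (proj₁ w~w′ ∘ sym)) (Adjacent-sym w~w′))

    cover : Move b B M′ B′ → (∀ {y} → y ∈ˢ B′ → y ≡ w′ ⊎ y ∈ˢ B) → w′ ∈ˢ B′ →
      (∀ {y} → y ∈ˢ B → HasNeighbourIn E M′ y → y ∈ˢ B′) → ∃ λ B′ → Move b B M′ B′ × Blocking M′ B′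
    cover {B′ = B′} mv′ B′⊆ w′∈B′ keeps = B′ , mv′ ,
      Blocking-after-fresh inv mv w∈M′ w∉M (Sum.map₁ (λ { refl → w~w′ }) ∘ B′⊆)
        (λ w~y → subst (_∈ˢ B′) (Adjacent-functional w~w′ w~y) w′∈B′) keeps

    idle-token : b ≤ ∣ B ∣ → w′ ∉ˢ B → ∃ λ y → y ∈ˢ B × ¬ HasNeighbourIn E M′ y
    idle-token b≤∣B∣ w′∉B = decidable-stable (any? λ y → y ∈? B ×-dec ¬? (hasNeighbourIn? E M′ y))
      λ all-needed → <-irrefl refl (oversized all-needed)
      where
      open ≤-Reasoning
      oversized : ¬ (∃ λ y → y ∈ˢ B × ¬ HasNeighbourIn E M′ y) → suc ∣ B ∣ ≤ ∣ B ∣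
      oversized all-needed = begin
        suc ∣ B ∣            ≡⟨ ∣insert∣ w′∉B ⟨
        ∣ B [ w′ ]≔ inside ∣ ≤⟨ ⊓-glb (neighbours⇒∣p∣≤∣q∣ neighbour) (neighbours⇒∣p∣≤∣E∣ neighbour outside-M′) ⟩
        ∣ M′ ∣ ⊓ length E    ≤⟨ ⊓-monoˡ-≤ (length E) (Move-∣∣≤ mv (bounded inv)) ⟩
        a ⊓ length E         ≤⟨ min≤b ⟩
        b                    ≤⟨ b≤∣B∣ ⟩
        ∣ B ∣                ∎
        where
        neighbour : ∀ {y} → y ∈ˢ B [ w′ ]≔ inside → HasNeighbourIn E M′ y
        neighbour y∈ with ∈-insert⁻ y∈
        ... | inj₁ refl = w , w∈M′ , Adjacent-sym w~w′
        ... | inj₂ y∈B = decidable-stable (hasNeighbourIn? E M′ _) (λ idle → all-needed (_ , y∈B , idle))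

        outside-M′ : ∀ {y} → y ∈ˢ B [ w′ ]≔ inside → y ∉ˢ M′
        outside-M′ y∈ y∈M′ with ∈-insert⁻ y∈
        ... | inj₁ refl = w′∉M′ y∈M′
        ... | inj₂ y∈B = separate′ inv mv y∈M′ y∈B

    cases : ∃ λ B′ → Move b B M′ B′ × Blocking M′ B′
    cases with w′ ∈? B
    ... | yes w′∈B = cover pass inj₂ w′∈B (λ y∈B _ → y∈B)
    ... | no w′∉B with ∣ B ∣ <? b
    ...   | yes room = cover (place w′ w′∉B w′∉M′ room) ∈-insert⁻ ([]≔-updates B w′) (λ y∈B _ → ∈-insert⁺ y∈B)
    ...   | no full with y₀ , y₀∈B , y₀-idle ← idle-token (≮⇒≥ full) w′∉B =
      cover (shift y₀ w′ y₀∈B w′∉B w′∉M′) (Sum.map₂ ∈-remove⁻ ∘ ∈-insert⁻) ([]≔-updates _ w′)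
        (λ y∈B needed → ∈-insert⁺ (∈-update⁺ (λ { refl → y₀-idle needed }) y∈B))

  respond : Blocking M B → Move a M B M′ → ∃ λ B′ → Move b B M′ B′ × Blocking M′ B′
  respond {M = M} {B = B} {M′ = M′} inv mv with any? (λ w → w ∈? M′ ×-dec ¬? (w ∈? M))
  ... | yes (w , w∈M′ , w∉M) with any? (adjacent? E w)
  ...   | yes (w′ , w~w′) = cover-partner inv mv w∈M′ w∉M w~w′
  ...   | no isolated = B , pass ,
    Blocking-after-fresh inv mv w∈M′ w∉M inj₂ (λ w~y → contradiction (_ , w~y) isolated) (λ y∈B _ → y∈B)
  respond {M = M} {B = B} {M′ = M′} inv mv | no no-fresh = B , pass , record
    { separate = λ x∈M′ → separate inv (old x∈M′)
    ; blocked  = λ x∈M′ → blocked inv (old x∈M′)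
    ; bounded  = Move-∣∣≤ mv (bounded inv)
    }
    where
    old : M′ ⊆ M
    old {x} x∈M′ = decidable-stable (x ∈? M) (λ x∉M → no-fresh (x , x∈M′ , x∉M))

  breakerWins : BreakerWins E a b
  breakerWins = breakerWins-by-invariant Blocking safe respond record
    { separate = λ x∈∅ → contradiction x∈∅ ∉⊥
    ; blocked  = λ x∈∅ → contradiction x∈∅ ∉⊥
    ; bounded  = subst (_≤ a) (sym (∣⊥∣≡0 n)) z≤n
    }

module MakerStrategy {n} {E : List (Subset n)} (unique : Unique E) (two-uniform : TwoUniform E)
  (disjoint : PairwiseDisjoint E) {a b : ℕ} (2≤a : 2 ≤ a) (b<min : b < a ⊓ length E) where
  open TwoUniformEdges two-uniform
  open Matching two-uniform disjoint

  OnEdges : Subset n → Set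
  OnEdges M = ∀ {x} → x ∈ˢ M → ∃ (Adjacent E x)

  ∣M∣≤b : OnEdges M → ∣ B ∣ ≤ b → ¬ Threat E M B → ∣ M ∣ ≤ b
  ∣M∣≤b {M = M} {B = B} on-edges ∣B∣≤b no-threat = ≤-trans (neighbours⇒∣p∣≤∣q∣ blocked) ∣B∣≤b
    where
    blocked : ∀ {x} → x ∈ˢ M → HasNeighbourIn E B x
    blocked {x} x∈M with y , x~y ← on-edges x∈M =
      y , decidable-stable (y ∈? B) (λ y∉B → no-threat (x , y , x∈M , x~y , y∉B)) , x~y

  ∣M∣<a : OnEdges M → ∣ B ∣ ≤ b → ¬ Threat E M B → ∣ M ∣ < a
  ∣M∣<a on-edges ∣B∣≤b no-threat = ≤-<-trans (∣M∣≤b on-edges ∣B∣≤b no-threat) (m<n⊓o⇒m<n a (length E) b<min)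

  unclaimed-vertex : ∣ B ∣ ≤ b → ¬ Threat E M B → ∃₂ λ x y → Adjacent E x y × x ∉ˢ M × x ∉ˢ B
  unclaimed-vertex {B = B} ∣B∣≤b no-threat with Any.any? (λ e → ¬? (nonempty? (e ∩ B))) E
  ... | no every-edge-met =
    contradiction (≤-trans (meets⇒∣E∣≤∣q∣ unique met) ∣B∣≤b) (<⇒≱ (m<n⊓o⇒m<o a (length E) b<min))
    where
    met : ∀ {e} → e ∈ˡ E → Nonempty (e ∩ B)
    met e∈E = decidable-stable (nonempty? _) (λ empty → every-edge-met (lose e∈E empty))
  ... | yes free-edge
    with e , e∈E , e∩B≡∅ ← find free-edge
    with x , x∈e ← edge-nonempty e∈E
    with y , y∈e , x~y ← partner e∈E x∈e
    = x , y , x~y , (λ x∈M → no-threat (x , y , x∈M , x~y , unblocked y∈e)) , unblocked x∈e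
    where
    unblocked : ∀ {v} → v ∈ˢ e → v ∉ˢ B
    unblocked v∈e v∈B = e∩B≡∅ (_ , x∈p∩q⁺ (v∈e , v∈B))

  -- Maker's strategy raises the rank at every turn, so it never repeats a position.
  rank : State n → ℕ
  rank (st M _ breaker) = 2 * ∣ M ∣
  rank (st M _ maker) = suc (2 * ∣ M ∣)

  Earlier : State n → List (State n) → Set
  Earlier t = All (λ s → rank s < rank t)

  Earlier-fresh : ∀ {t} → Earlier t hist → t ∉ˡ hist
  Earlier-fresh earlier t∈ = <-irrefl refl (All.lookup earlier t∈)

  Earlier-∷ : ∀ {t t′} → rank t < rank t′ → Earlier t hist → Earlier t′ (t ∷ hist)
  Earlier-∷ t<t′ earlier = t<t′ ∷ All.map (λ s<t → <-trans s<t t<t′) earlier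

  mutual
    makerWins : ∀ fuel → Earlier (st M B maker) hist → OnEdges M → ∣ B ∣ ≤ b → b < ∣ M ∣ + fuel →
      ¬ BWin E a b hist (st M B maker)
    makerWins {M = M} {B = B} fuel earlier on-edges ∣B∣≤b fuel-ok bw with threat? E M B
    ... | yes threat = threat⇒¬BWin 2≤a (Earlier-fresh earlier) threat bw
    ... | no no-threat = extend fuel earlier on-edges ∣B∣≤b no-threat fuel-ok bw

    extend : ∀ fuel → Earlier (st M B maker) hist → OnEdges M → ∣ B ∣ ≤ b → ¬ Threat E M B → b < ∣ M ∣ + fuel →
      ¬ BWin E a b hist (st M B maker)
    extend zero _ on-edges ∣B∣≤b no-threat fuel-ok _ =
      ≤⇒≯ (∣M∣≤b on-edges ∣B∣≤b no-threat) (subst (b <_) (+-identityʳ _) fuel-ok)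
    extend {M = M} {B = B} (suc fuel) earlier on-edges ∣B∣≤b no-threat fuel-ok bw
      with x , y , x~y , x∉M , x∉B ← unclaimed-vertex ∣B∣≤b no-threat
      with _ , bw′ ← BWin-maker⁻ (Earlier-fresh earlier) bw (place x x∉M x∉B (∣M∣<a on-edges ∣B∣≤b no-threat))
      = breakerLoses fuel (Earlier-∷ {t′ = st (M [ x ]≔ inside) B breaker} ranked earlier)
          on-edges′ ∣B∣≤b fuel-ok′ bw′
      where
      ranked : rank (st M B maker) < rank (st (M [ x ]≔ inside) B breaker)
      ranked = subst (λ k → suc (2 * ∣ M ∣) < 2 * k) (sym (∣insert∣ x∉M)) (≤-reflexive (sym (*-suc 2 ∣ M ∣)))

      on-edges′ : OnEdges (M [ x ]≔ inside)
      on-edges′ x′∈ = [ (λ { refl → y , x~y }) , on-edges ] (∈-insert⁻ x′∈)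

      fuel-ok′ : b < ∣ M [ x ]≔ inside ∣ + fuel
      fuel-ok′ = subst (b <_) (trans (+-suc ∣ M ∣ fuel) (cong (_+ fuel) (sym (∣insert∣ x∉M)))) fuel-ok

    breakerLoses : ∀ fuel → Earlier (st M B breaker) hist → OnEdges M → ∣ B ∣ ≤ b → b < ∣ M ∣ + fuel →
      ¬ BWin E a b hist (st M B breaker)
    breakerLoses {M = M} fuel earlier on-edges ∣B∣≤b fuel-ok bw
      with B′ , mv , bw′ ← BWin-breaker⁻ (Earlier-fresh earlier) bw =
      makerWins fuel (Earlier-∷ {t′ = st M B′ maker} (n<1+n _) earlier) on-edges (Move-∣∣≤ mv ∣B∣≤b) fuel-ok bw′

  ¬breakerWins : ¬ BreakerWins E a b
  ¬breakerWins = makerWins (suc b) [] (λ x∈∅ → contradiction x∈∅ ∉⊥)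
    (subst (_≤ b) (sym (∣⊥∣≡0 n)) z≤n) (subst (λ k → b < k + suc b) (sym (∣⊥∣≡0 n)) ≤-refl)

proposition2p4 : (n : ℕ) (E : List (Subset n)) → Unique E → TwoUniform E →
    (a b : ℕ) → 2 ≤ a →
    BreakerWins E a b ⇔ (PairwiseDisjoint E × a ⊓ length E ≤ b)
proposition2p4 n E unique two-uniform a b 2≤a = mk⇔ necessary sufficient
  where
  open TwoUniformEdges two-uniform

  necessary : BreakerWins E a b → PairwiseDisjoint E × a ⊓ length E ≤ b
  necessary bw = disjoint , ≮⇒≥ λ b<min → MakerStrategy.¬breakerWins unique two-uniform disjoint 2≤a b<min bw
    where
    disjoint : PairwiseDisjoint E
    disjoint = BreakerWins⇒PairwiseDisjoint 2≤a bw

  sufficient : PairwiseDisjoint E × a ⊓ length E ≤ b → BreakerWins E a b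
  sufficient (disjoint , min≤b) = BlockingStrategy.breakerWins two-uniform disjoint min≤b
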